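{- Let $k\geq 4$. A permutation $\pi\in S_k$ belongs to $B_k$ if and only if $\operatorname{Sh}_{k-1}(\pi)$ consists of exactly one monotone pattern and one element of $B_{k-1}$.
   Context: $S_k$ is the set of permutations of $\{1,\dots,k\}$ in one-line notation; $\pi^c(i)=k+1-\pi(i)$ is the complement. For $k\geq 3$, $p_k=12\cdots(k-2)\,k\,(k-1)$, $q_k=1\,k\,(k-1)\cdots 2$, $r_k=2\,1\,3\,4\cdots k$, $s_k=2\,3\cdots k\,1$, and $B_k=\{p_k,q_k,r_k,s_k,p_k^c,q_k^c,r_k^c,s_k^c\}$. For $\pi\in S_n$ and $1\le \ell\le n$, the shadow $\operatorname{Sh}_\ell(\pi)$ is the set of patterns in $S_\ell$ contained (classically) in $\pi$. A monotone pattern of length $\ell$ is $12\cdots\ell$ or $\ell\cdots 21$. -}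

module Defs where

open import Data.Nat using (ℕ; suc; _+_; _∸_; _<_)
open import Data.List using (List; []; _∷_; _++_; map; upTo; reverse)
open import Data.List.Membership.Propositional using (_∈_)
open import Data.List.Relation.Binary.Permutation.Propositional using (_↭_)
open import Data.List.Relation.Binary.Sublist.Propositional using (_⊆_)
open import Data.List.Relation.Binary.Pointwise using (Pointwise)
open import Data.Product using (_×_; ∃-syntax)
open import Data.Sum using (_⊎_)
open import Data.Unit using (⊤)
open import Data.Empty using (⊥)
open import Function.Bundles using (_⇔_)
open import Relation.Binary.PropositionalEquality using (_≡_)

range : ℕ → ℕ → List ℕ
range a n = map (a +_) (upTo n)

-- w is a permutation of {1,...,k} in one-line notation
IsPerm : ℕ → List ℕ → Set
IsPerm k w = w ↭ range 1 k

comp : ℕ → List ℕ → List ℕ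
comp k w = map (λ x → suc k ∸ x) w

pk qk rk sk : ℕ → List ℕ
pk k = range 1 (k ∸ 2) ++ (k ∷ (k ∸ 1) ∷ [])
qk k = 1 ∷ reverse (range 2 (k ∸ 1))
rk k = 2 ∷ 1 ∷ range 3 (k ∸ 2)
sk k = range 2 (k ∸ 1) ++ (1 ∷ [])

Blist : ℕ → List (List ℕ)
Blist k = pk k ∷ qk k ∷ rk k ∷ sk k
        ∷ comp k (pk k) ∷ comp k (qk k) ∷ comp k (rk k) ∷ comp k (sk k) ∷ []

InB : ℕ → List ℕ → Set
InB k w = w ∈ Blist k

-- order-isomorphism of two sequences (of distinct entries):
-- same length and x_i < x_j iff y_i < y_j for all i < j
OrdIso : List ℕ → List ℕ → Set
OrdIso [] [] = ⊤
OrdIso [] (_ ∷ _) = ⊥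
OrdIso (_ ∷ _) [] = ⊥
OrdIso (x ∷ xs) (y ∷ ys) =
  Pointwise (λ x' y' → (x < x' ⇔ y < y') × (x' < x ⇔ y' < y)) xs ys × OrdIso xs ys

Contains : List ℕ → List ℕ → Set
Contains π σ = ∃[ τ ] (τ ⊆ π × OrdIso σ τ)

InShadow : ℕ → List ℕ → List ℕ → Set
InShadow ℓ π σ = IsPerm ℓ σ × Contains π σ

Monotone : ℕ → List ℕ → Set
Monotone ℓ σ = σ ≡ range 1 ℓ ⊎ σ ≡ reverse (range 1 ℓ)

{-# OPTIONS --safe #-}
module Submission where

-- The (k − 1)-patterns of a permutation π of 1 … k are exactly its deletions delete v π (erase the
-- entry v and close the gap), because a permutation is determined by its order type.
-- Complementation reverses the order, so it commutes with taking patterns and preserves B and the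
-- monotone patterns; hence we may assume that the monotone deletion is the identity. Then π is the
-- identity with one entry moved, oneMove d ℓ e z. Deleting an entry of the initial run, an unmoved
-- entry of the rotated block, or an entry of the final run lowers ℓ, e or z by one, and oneMove
-- determines ℓ and e, so if two of ℓ, e − 1 and z are positive then π has two distinct deletions
-- besides the identity. The remaining shapes are p_k, r_k, s_k and q_k^c, whose two deletions are
-- computed directly, and B is their closure under complementation.

open import Defs
open import Data.Empty using (⊥-elim)
open import Data.List using (List; []; _∷_; _++_; [_]; map; filter; length; reverse; applyUpTo)
open import Data.List.Properties
  using ( map-upTo; map-++; map-∘; map-id-local; ++-assoc; ++-identityʳ; ++-cancelˡ; length-++
        ; filter-++; filter-all; filter-none; filter-accept; filter-reject
        ; reverse-++; reverse-map; reverse-involutive; ∷-injective; ∷-injectiveˡ; ∷-injectiveʳ )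
open import Data.List.Membership.Propositional using (_∈_)
open import Data.List.Membership.Propositional.Properties using (∈-++⁺ˡ; ∈-++⁺ʳ; ∈-++⁻; ∈-∃++)
open import Data.List.Relation.Binary.Permutation.Propositional using (_↭_; ↭-sym; ↭-trans; ↭⇒↭ₛ)
open import Data.List.Relation.Binary.Permutation.Propositional.Properties
  using (∈-resp-↭; All-resp-↭; ↭-length; ↭-reverse; ∷↭∷ʳ; filter-↭; map⁺)
open import Data.List.Relation.Binary.Pointwise as Pointwise using (Pointwise; []; _∷_; Pointwise-≡⇒≡)
open import Data.List.Relation.Binary.Sublist.Propositional using (_⊆_; _∷_; _∷ʳ_)
open import Data.List.Relation.Binary.Sublist.Propositional.Properties as Sublist using (filter-⊆; to-≋; All-resp-⊆)
open import Data.List.Relation.Unary.All as All using (All; []; _∷_)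
import Data.List.Relation.Unary.All.Properties as All
open import Data.List.Relation.Unary.AllPairs using (_∷_)
open import Data.List.Relation.Unary.Any using (here; there)
open import Data.List.Relation.Unary.Unique.Propositional using (Unique)
import Data.List.Relation.Unary.Unique.Propositional.Properties as Unique
open import Data.Nat using (ℕ; zero; suc; pred; _+_; _∸_; _≤_; _<_; _≟_; _<?_; z≤n; s≤s)
open import Data.Nat.Properties
open import Data.Product as Product using (_×_; _,_; proj₁; proj₂; ∃-syntax)
open import Data.Sum using (_⊎_; inj₁; inj₂)
open import Data.Unit using (tt)
open import Function using (_∘_)
open import Function.Bundles using (_⇔_; mk⇔; Equivalence)
open import Function.Construct.Composition using (_⇔-∘_)
open import Function.Construct.Symmetry using (⇔-sym)
open import Relation.Binary.Definitions using (tri<; tri≈; tri>)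
open import Relation.Binary.PropositionalEquality hiding ([_])
open import Relation.Nullary using (¬_; Dec; yes; no; ¬?)
open import Data.List.Relation.Binary.Permutation.Setoid.Properties (setoid ℕ) using (Unique-resp-↭)

open Equivalence using (to; from)

-- Runs of consecutive values

upFrom : ℕ → ℕ → List ℕ
upFrom a zero    = []
upFrom a (suc m) = a ∷ upFrom (suc a) m

applyUpTo≡upFrom : ∀ {f} a m → (∀ i → f i ≡ a + i) → applyUpTo f m ≡ upFrom a m
applyUpTo≡upFrom a zero    f≗ = refl
applyUpTo≡upFrom a (suc m) f≗ =
  cong₂ _∷_ (trans (f≗ 0) (+-identityʳ a)) (applyUpTo≡upFrom (suc a) m (λ i → trans (f≗ (suc i)) (+-suc a i)))

range≡upFrom : ∀ a m → range a m ≡ upFrom a m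
range≡upFrom a m = trans (map-upTo (a +_) m) (applyUpTo≡upFrom a m (λ _ → refl))

length-upFrom : ∀ a m → length (upFrom a m) ≡ m
length-upFrom a zero    = refl
length-upFrom a (suc m) = cong suc (length-upFrom (suc a) m)

upFrom-++ : ∀ a m p → upFrom a (m + p) ≡ upFrom a m ++ upFrom (a + m) p
upFrom-++ a zero    p = cong (λ b → upFrom b p) (sym (+-identityʳ a))
upFrom-++ a (suc m) p =
  cong (a ∷_) (trans (upFrom-++ (suc a) m p) (cong (λ b → upFrom (suc a) m ++ upFrom b p) (sym (+-suc a m))))

upFrom-∷ʳ : ∀ a m → upFrom a (suc m) ≡ upFrom a m ++ [ a + m ]
upFrom-∷ʳ a zero    = cong [_] (sym (+-identityʳ a))
upFrom-∷ʳ a (suc m) =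
  cong (a ∷_) (trans (upFrom-∷ʳ (suc a) m) (cong (λ c → upFrom (suc a) m ++ [ c ]) (sym (+-suc a m))))

reverse-upFrom-suc : ∀ a m → reverse (upFrom a (suc m)) ≡ a + m ∷ reverse (upFrom a m)
reverse-upFrom-suc a m = trans (cong reverse (upFrom-∷ʳ a m)) (reverse-++ (upFrom a m) [ a + m ])

map-suc-upFrom : ∀ a m → map suc (upFrom a m) ≡ upFrom (suc a) m
map-suc-upFrom a zero    = refl
map-suc-upFrom a (suc m) = cong (suc a ∷_) (map-suc-upFrom (suc a) m)

∈-upFrom⁻ : ∀ {x} a m → x ∈ upFrom a m → a ≤ x × x < a + m
∈-upFrom⁻ a (suc m) (here refl) = ≤-refl , m<m+n a (s≤s z≤n)
∈-upFrom⁻ {x} a (suc m) (there x∈) with ∈-upFrom⁻ (suc a) m x∈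
... | a<x , x<a+m = <⇒≤ a<x , subst (x <_) (sym (+-suc a m)) x<a+m

upFrom-lower : ∀ a m → All (a ≤_) (upFrom a m)
upFrom-lower a m = All.tabulate (proj₁ ∘ ∈-upFrom⁻ a m)

upFrom-upper : ∀ a m → All (_< a + m) (upFrom a m)
upFrom-upper a m = All.tabulate (proj₂ ∘ ∈-upFrom⁻ a m)

++-split-≤ : ∀ (xs ys us zs : List ℕ) → xs ++ ys ≡ us ++ zs → length us ≤ length xs →
             ∃[ ws ] (xs ≡ us ++ ws × zs ≡ ws ++ ys)
++-split-≤ xs       ys []       zs eq _         = xs , refl , sym eq
++-split-≤ (x ∷ xs) ys (u ∷ us) zs eq (s≤s us≤xs) with ∷-injective eq
... | refl , eq′ with ++-split-≤ xs ys us zs eq′ us≤xs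
...   | ws , refl , refl = ws , refl , refl

upFrom-++⁻ : ∀ a xs ws {m} → xs ++ ws ≡ upFrom a m →
             xs ≡ upFrom a (length xs) × ws ≡ upFrom (a + length xs) (length ws)
upFrom-++⁻ a []       ws {m} refl = refl , cong₂ upFrom (sym (+-identityʳ a)) (sym (length-upFrom a m))
upFrom-++⁻ a (x ∷ xs) ws {suc m} eq with ∷-injective eq
... | refl , eq′ with upFrom-++⁻ (suc a) xs ws eq′
...   | xs≡ , ws≡ = cong (a ∷_) xs≡ , trans ws≡ (cong (λ b → upFrom b (length ws)) (sym (+-suc a (length xs))))

run : ℕ → List ℕ → ℕ
run a []       = 0
run a (x ∷ xs) with x ≟ a
... | yes _ = suc (run (suc a) xs)
... | no  _ = 0

run-upFrom : ∀ a n → run a (upFrom a n) ≡ n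
run-upFrom a zero    = refl
run-upFrom a (suc n) with a ≟ a
... | yes _   = cong suc (run-upFrom (suc a) n)
... | no  a≢a = ⊥-elim (a≢a refl)

run-upFrom-++ : ∀ a ℓ {x xs} → x ≢ a + ℓ → run a (upFrom a ℓ ++ x ∷ xs) ≡ ℓ
run-upFrom-++ a zero {x} x≢a+0 with x ≟ a
... | yes refl = ⊥-elim (x≢a+0 (sym (+-identityʳ a)))
... | no  _    = refl
run-upFrom-++ a (suc ℓ) x≢a+1+ℓ with a ≟ a
... | yes _   = cong suc (run-upFrom-++ (suc a) ℓ (λ x≡ → x≢a+1+ℓ (trans x≡ (sym (+-suc a ℓ)))))
... | no  a≢a = ⊥-elim (a≢a refl)

-- Deleting a value

reduce : ℕ → ℕ → ℕ
reduce v x with v <? x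
... | yes _ = pred x
... | no  _ = x

reduce-above : ∀ {v x} → v < x → reduce v x ≡ pred x
reduce-above {v} {x} v<x with v <? x
... | yes _   = refl
... | no  v≮x = ⊥-elim (v≮x v<x)

reduce-below : ∀ {v x} → x ≤ v → reduce v x ≡ x
reduce-below {v} {x} x≤v with v <? x
... | yes v<x = ⊥-elim (<⇒≱ v<x x≤v)
... | no  _   = refl

reduce-monotone : ∀ {v a b} → a ≢ v → b ≢ v → a < b ⇔ reduce v a < reduce v b
reduce-monotone {v} {a} {b} a≢v b≢v with <-cmp a v | <-cmp b v
... | tri< a<v _ _ | tri< b<v _ _
  rewrite reduce-below (<⇒≤ a<v) | reduce-below (<⇒≤ b<v) = mk⇔ (λ a<b → a<b) (λ a<b → a<b)
... | tri< a<v _ _ | tri> _ _ v<b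
  rewrite reduce-below (<⇒≤ a<v) | reduce-above v<b =
    mk⇔ (λ _ → <-≤-trans a<v (<⇒≤pred v<b)) (λ _ → <-trans a<v v<b)
... | tri> _ _ v<a | tri< b<v _ _
  rewrite reduce-above v<a | reduce-below (<⇒≤ b<v) =
    mk⇔ (λ a<b → ⊥-elim (<-asym a<b (<-trans b<v v<a)))
        (λ a′<b → ⊥-elim (<⇒≱ a′<b (≤-trans (<⇒≤ b<v) (<⇒≤pred v<a))))
... | tri> _ _ v<a | tri> _ _ v<b
  rewrite reduce-above v<a | reduce-above v<b = pred-⇔ (≤-<-trans z≤n v<a) (≤-<-trans z≤n v<b)
  where
  pred-⇔ : ∀ {a b} → 0 < a → 0 < b → a < b ⇔ pred a < pred b
  pred-⇔ {suc a} {suc b} _ _ = mk⇔ ≤-pred s≤s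
... | tri≈ _ a≡v _ | _ = ⊥-elim (a≢v a≡v)
... | _ | tri≈ _ b≡v _ = ⊥-elim (b≢v b≡v)

reduce-injective : ∀ {v x y} → x ≢ v → y ≢ v → reduce v x ≡ reduce v y → x ≡ y
reduce-injective {v} {x} {y} x≢v y≢v eq with <-cmp x y
... | tri< x<y _ _ = ⊥-elim (<⇒≢ (to (reduce-monotone x≢v y≢v) x<y) eq)
... | tri≈ _ x≡y _ = x≡y
... | tri> _ _ y<x = ⊥-elim (<⇒≢ (to (reduce-monotone y≢v x≢v) y<x) (sym eq))

map-injectiveOn : ∀ {P : ℕ → Set} {f : ℕ → ℕ} → (∀ {x y} → P x → P y → f x ≡ f y → x ≡ y) →
                  ∀ {xs ys} → All P xs → All P ys → map f xs ≡ map f ys → xs ≡ ys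
map-injectiveOn inj []         []         _  = refl
map-injectiveOn inj (px ∷ pxs) (py ∷ pys) eq =
  cong₂ _∷_ (inj px py (∷-injectiveˡ eq)) (map-injectiveOn inj pxs pys (∷-injectiveʳ eq))

_≢?_ : (x v : ℕ) → Dec (x ≢ v)
x ≢? v = ¬? (x ≟ v)

delete : ℕ → List ℕ → List ℕ
delete v xs = map (reduce v) (filter (_≢? v) xs)

delete-++ : ∀ v xs ys → delete v (xs ++ ys) ≡ delete v xs ++ delete v ys
delete-++ v xs ys = trans (cong (map (reduce v)) (filter-++ (_≢? v) xs ys)) (map-++ (reduce v) (filter (_≢? v) xs) _)

delete-∷-self : ∀ v xs → delete v (v ∷ xs) ≡ delete v xs
delete-∷-self v xs = cong (map (reduce v)) (filter-reject (_≢? v) (λ v≢v → v≢v refl))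

delete-∷-below : ∀ {v x} xs → x < v → delete v (x ∷ xs) ≡ x ∷ delete v xs
delete-∷-below xs x<v =
  trans (cong (map (reduce _)) (filter-accept (_≢? _) (<⇒≢ x<v))) (cong (_∷ _) (reduce-below (<⇒≤ x<v)))

delete-∷-above : ∀ {v x} xs → v < x → delete v (x ∷ xs) ≡ pred x ∷ delete v xs
delete-∷-above xs v<x =
  trans (cong (map (reduce _)) (filter-accept (_≢? _) (>⇒≢ v<x))) (cong (_∷ _) (reduce-above v<x))

delete-below : ∀ {v xs} → All (_< v) xs → delete v xs ≡ xs
delete-below {v} xs<v =
  trans (cong (map (reduce v)) (filter-all (_≢? v) (All.map <⇒≢ xs<v)))
        (map-id-local (All.map (reduce-below ∘ <⇒≤) xs<v))

delete-above : ∀ {v xs} → All (v ≤_) xs → delete v (map suc xs) ≡ xs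
delete-above {v} {xs} v≤xs =
  trans (cong (map (reduce v)) (filter-all (_≢? v) (All.map⁺ (All.map (>⇒≢ ∘ s≤s) v≤xs))))
        (trans (sym (map-∘ xs)) (map-id-local (All.map (reduce-above ∘ s≤s) v≤xs)))

delete-between : ∀ {v} xs ys zs → All (_< v) xs → All (v ≤_) zs →
                 delete v (xs ++ ys ++ map suc zs) ≡ xs ++ delete v ys ++ zs
delete-between {v} xs ys zs xs<v v≤zs = begin
  delete v (xs ++ ys ++ map suc zs)                  ≡⟨ delete-++ v xs _ ⟩
  delete v xs ++ delete v (ys ++ map suc zs)         ≡⟨ cong₂ _++_ (delete-below xs<v) (delete-++ v ys _) ⟩
  xs ++ delete v ys ++ delete v (map suc zs)         ≡⟨ cong (λ ws → xs ++ delete v ys ++ ws) (delete-above v≤zs) ⟩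
  xs ++ delete v ys ++ zs                            ∎
  where open ≡-Reasoning

delete-upFrom : ∀ {v} a m → v ∈ upFrom a (suc m) → delete v (upFrom a (suc m)) ≡ upFrom a m
delete-upFrom a m (here refl) = begin
  delete a (a ∷ upFrom (suc a) m)      ≡⟨ delete-∷-self a _ ⟩
  delete a (upFrom (suc a) m)          ≡⟨ cong (delete a) (sym (map-suc-upFrom a m)) ⟩
  delete a (map suc (upFrom a m))      ≡⟨ delete-above (upFrom-lower a m) ⟩
  upFrom a m                           ∎
  where open ≡-Reasoning
delete-upFrom a (suc m) (there v∈) =
  trans (delete-∷-below _ (proj₁ (∈-upFrom⁻ (suc a) (suc m) v∈))) (cong (a ∷_) (delete-upFrom (suc a) m v∈))

delete-↭ : ∀ v {xs ys} → xs ↭ ys → delete v xs ↭ delete v ys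
delete-↭ v xs↭ys = map⁺ (reduce v) (filter-↭ (_≢? v) xs↭ys)

-- Permutations

InRange : ℕ → ℕ → Set
InRange k x = 1 ≤ x × x ≤ k

perm-inRange : ∀ {k w} → IsPerm k w → All (InRange k) w
perm-inRange {k} w↭ = All.tabulate λ x∈w →
  let 1≤x , x<1+k = ∈-upFrom⁻ 1 k (subst (_ ∈_) (range≡upFrom 1 k) (∈-resp-↭ w↭ x∈w))
  in 1≤x , ≤-pred x<1+k

perm-length : ∀ {k w} → IsPerm k w → length w ≡ k
perm-length {k} w↭ = trans (↭-length w↭) (trans (cong length (range≡upFrom 1 k)) (length-upFrom 1 k))

perm-unique : ∀ {k w} → IsPerm k w → Unique w
perm-unique {k} w↭ = Unique-resp-↭ (↭⇒↭ₛ (↭-sym w↭)) (Unique.map⁺ suc-injective (Unique.upTo⁺ k))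

unique-middle : ∀ (xs : List ℕ) {v ys} → Unique (xs ++ v ∷ ys) → All (_≢ v) (xs ++ ys)
unique-middle []       (v≢ys ∷ _)    = All.map (λ v≢y y≡v → v≢y (sym y≡v)) v≢ys
unique-middle (x ∷ xs) (x≢rest ∷ u) = All.lookup x≢rest (∈-++⁺ʳ xs (here refl)) ∷ unique-middle xs u

filter-≢-middle : ∀ (xs : List ℕ) {v ys} → Unique (xs ++ v ∷ ys) → filter (_≢? v) (xs ++ v ∷ ys) ≡ xs ++ ys
filter-≢-middle xs {v} {ys} u = begin
  filter (_≢? v) (xs ++ v ∷ ys)                  ≡⟨ filter-++ (_≢? v) xs (v ∷ ys) ⟩
  filter (_≢? v) xs ++ filter (_≢? v) (v ∷ ys)   ≡⟨ cong (filter (_≢? v) xs ++_) (filter-reject (_≢? v) (λ v≢v → v≢v refl)) ⟩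
  filter (_≢? v) xs ++ filter (_≢? v) ys         ≡⟨ filter-++ (_≢? v) xs ys ⟨
  filter (_≢? v) (xs ++ ys)                      ≡⟨ filter-all (_≢? v) (unique-middle xs u) ⟩
  xs ++ ys                                       ∎
  where open ≡-Reasoning

delete-middle : ∀ (xs : List ℕ) {v ys} → Unique (xs ++ v ∷ ys) →
                delete v (xs ++ v ∷ ys) ≡ map (reduce v) (xs ++ ys)
delete-middle xs u = cong (map (reduce _)) (filter-≢-middle xs u)

delete-perm : ∀ {n π v} → IsPerm (suc n) π → v ∈ π → IsPerm n (delete v π)
delete-perm {n} {π} {v} π↭ v∈π = subst (delete v π ↭_) deleted (delete-↭ v π↭)
  where
  v∈ : v ∈ upFrom 1 (suc n)
  v∈ = subst (v ∈_) (range≡upFrom 1 (suc n)) (∈-resp-↭ π↭ v∈π)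
  deleted : delete v (range 1 (suc n)) ≡ range 1 n
  deleted = trans (cong (delete v) (range≡upFrom 1 (suc n)))
                  (trans (delete-upFrom 1 n v∈) (sym (range≡upFrom 1 n)))

-- Order isomorphisms

OrdIso-length : ∀ xs ys → OrdIso xs ys → length xs ≡ length ys
OrdIso-length []       []       _         = refl
OrdIso-length (x ∷ xs) (y ∷ ys) (_ , iso) = cong suc (OrdIso-length xs ys iso)

OrdIso-sym : ∀ xs ys → OrdIso xs ys → OrdIso ys xs
OrdIso-sym []       []       _          = tt
OrdIso-sym (x ∷ xs) (y ∷ ys) (pw , iso) =
  Pointwise.symmetric (Product.map ⇔-sym ⇔-sym) pw , OrdIso-sym xs ys iso

OrdIso-trans : ∀ xs ys zs → OrdIso xs ys → OrdIso ys zs → OrdIso xs zs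
OrdIso-trans []       []       []       _          _            = tt
OrdIso-trans (x ∷ xs) (y ∷ ys) (z ∷ zs) (pw , iso) (pw′ , iso′) =
  Pointwise.transitive (λ (p , q) (p′ , q′) → p′ ⇔-∘ p , q′ ⇔-∘ q) pw pw′ ,
  OrdIso-trans xs ys zs iso iso′

module _ {P : ℕ → Set} {f : ℕ → ℕ} (mono : ∀ {a b} → P a → P b → a < b ⇔ f a < f b) where

  OrdIso-map-monotone : ∀ {xs} → All P xs → OrdIso (map f xs) xs
  OrdIso-map-monotone {[]}     []         = tt
  OrdIso-map-monotone {x ∷ xs} (px ∷ pxs) = pointwise pxs , OrdIso-map-monotone pxs
    where
    pointwise : ∀ {ys} → All P ys → Pointwise (λ a b → (f x < a ⇔ x < b) × (a < f x ⇔ b < x)) (map f ys) ys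
    pointwise []         = []
    pointwise (py ∷ pys) = (⇔-sym (mono px py) , ⇔-sym (mono py px)) ∷ pointwise pys

module _ {P Q : ℕ → Set} {f g : ℕ → ℕ}
         (antiᶠ : ∀ {a b} → P a → P b → a < b ⇔ f b < f a)
         (antiᵍ : ∀ {a b} → Q a → Q b → a < b ⇔ g b < g a) where

  OrdIso-map-antitone : ∀ {xs ys} → All P xs → All Q ys → OrdIso xs ys → OrdIso (map f xs) (map g ys)
  OrdIso-map-antitone {[]}     {[]}     []         []         _          = tt
  OrdIso-map-antitone {x ∷ xs} {y ∷ ys} (px ∷ pxs) (qy ∷ qys) (pw , iso) =
    pointwise pw pxs qys , OrdIso-map-antitone pxs qys iso
    where
    pointwise : ∀ {as bs} → Pointwise (λ a b → (x < a ⇔ y < b) × (a < x ⇔ b < y)) as bs →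
                All P as → All Q bs →
                Pointwise (λ a b → (f x < a ⇔ g y < b) × (a < f x ⇔ b < g y)) (map f as) (map g bs)
    pointwise []                        []         []         = []
    pointwise ((x<a⇔y<b , a<x⇔b<y) ∷ pw) (pa ∷ pas) (qb ∷ qbs) =
      ( antiᵍ qb qy ⇔-∘ (a<x⇔b<y ⇔-∘ ⇔-sym (antiᶠ pa px))
      , antiᵍ qy qb ⇔-∘ (x<a⇔y<b ⇔-∘ ⇔-sym (antiᶠ px pa)) )
      ∷ pointwise pw pas qbs

OrdIso-delete : ∀ v xs → OrdIso (delete v xs) (filter (_≢? v) xs)
OrdIso-delete v xs = OrdIso-map-monotone reduce-monotone (All.all-filter (_≢? v) xs)

-- An entry x of a permutation of 1 … n equals 1 + rank x σ, and order isomorphisms preserve ranks.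
rank : ℕ → List ℕ → ℕ
rank x xs = length (filter (_<? x) xs)

rank-∷ : ∀ {a b x y xs ys} → (x < a ⇔ y < b) → rank a xs ≡ rank b ys → rank a (x ∷ xs) ≡ rank b (y ∷ ys)
rank-∷ {a} {b} {x} x<a⇔y<b eq with x <? a
... | yes x<a = trans (cong length (filter-accept (_<? a) x<a))
                      (trans (cong suc eq) (sym (cong length (filter-accept (_<? b) (to x<a⇔y<b x<a)))))
... | no  x≮a = trans (cong length (filter-reject (_<? a) x≮a))
                      (trans eq (sym (cong length (filter-reject (_<? b) (x≮a ∘ from x<a⇔y<b)))))

rank-pointwise : ∀ {x y xs ys} → Pointwise (λ a b → a < x ⇔ b < y) xs ys → rank x xs ≡ rank y ys
rank-pointwise []       = refl
rank-pointwise (e ∷ es) = rank-∷ e (rank-pointwise es)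

OrdIso-rank : ∀ xs ys → OrdIso xs ys → Pointwise (λ a b → rank a xs ≡ rank b ys) xs ys
OrdIso-rank []       []       _          = []
OrdIso-rank (x ∷ xs) (y ∷ ys) (pw , iso) =
  rank-∷ {x} {y} (mk⇔ (⊥-elim ∘ <-irrefl refl) (⊥-elim ∘ <-irrefl refl)) (rank-pointwise (Pointwise.map proj₂ pw))
  ∷ extend pw (OrdIso-rank xs ys iso)
  where
  extend : ∀ {as bs} → Pointwise (λ a b → (x < a ⇔ y < b) × (a < x ⇔ b < y)) as bs →
           Pointwise (λ a b → rank a xs ≡ rank b ys) as bs →
           Pointwise (λ a b → rank a (x ∷ xs) ≡ rank b (y ∷ ys)) as bs
  extend []              []         = []
  extend ((e , _) ∷ pw) (eq ∷ eqs) = rank-∷ e eq ∷ extend pw eqs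

rank-upFrom : ∀ a m i → i ≤ m → rank (a + i) (upFrom a m) ≡ i
rank-upFrom a m zero _ = cong length (filter-none (_<? a + 0) (All.map (λ a≤y y<a → <⇒≱ y<a (a+0≤ a≤y)) (upFrom-lower a m)))
  where
  a+0≤ : ∀ {y} → a ≤ y → a + 0 ≤ y
  a+0≤ = subst (_≤ _) (sym (+-identityʳ a))
rank-upFrom a (suc m) (suc i) (s≤s i≤m) = begin
  rank (a + suc i) (a ∷ upFrom (suc a) m)     ≡⟨ cong length (filter-accept (_<? a + suc i) (m<m+n a (s≤s z≤n))) ⟩
  suc (rank (a + suc i) (upFrom (suc a) m))   ≡⟨ cong (λ c → suc (rank c (upFrom (suc a) m))) (+-suc a i) ⟩
  suc (rank (suc a + i) (upFrom (suc a) m))   ≡⟨ cong suc (rank-upFrom (suc a) m i i≤m) ⟩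
  suc i                                       ∎
  where open ≡-Reasoning

perm-rank : ∀ {n σ} → IsPerm n σ → All (λ x → x ≡ suc (rank x σ)) σ
perm-rank {n} {σ} σ↭ = All.map entry (perm-inRange σ↭)
  where
  entry : ∀ {x} → InRange n x → x ≡ suc (rank x σ)
  entry {suc i} (_ , i<n) = cong suc (sym (begin
    rank (suc i) σ             ≡⟨ ↭-length (filter-↭ (_<? suc i) σ↭) ⟩
    rank (suc i) (range 1 n)   ≡⟨ cong (rank (suc i)) (range≡upFrom 1 n) ⟩
    rank (1 + i) (upFrom 1 n)  ≡⟨ rank-upFrom 1 n i (<⇒≤ i<n) ⟩
    i                          ∎))
    where open ≡-Reasoning

OrdIso-perm-unique : ∀ {n σ σ′} → IsPerm n σ → IsPerm n σ′ → OrdIso σ σ′ → σ ≡ σ′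
OrdIso-perm-unique {σ = σ} {σ′} σ↭ σ′↭ iso =
  Pointwise-≡⇒≡ (entrywise (OrdIso-rank σ σ′ iso) (perm-rank σ↭) (perm-rank σ′↭))
  where
  entrywise : ∀ {as bs} → Pointwise (λ a b → rank a σ ≡ rank b σ′) as bs →
              All (λ x → x ≡ suc (rank x σ)) as → All (λ x → x ≡ suc (rank x σ′)) bs → Pointwise _≡_ as bs
  entrywise []         []       []       = []
  entrywise (eq ∷ eqs) (a ∷ as) (b ∷ bs) = trans a (trans (cong suc eq) (sym b)) ∷ entrywise eqs as bs

-- Shadows and deletions

IsDeletion : List ℕ → List ℕ → Set
IsDeletion π σ = ∃[ v ] (v ∈ π × σ ≡ delete v π)

deletion-perm : ∀ {n π σ} → IsPerm (suc n) π → IsDeletion π σ → IsPerm n σ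
deletion-perm π↭ (v , v∈π , refl) = delete-perm π↭ v∈π

⊆-drop-one : ∀ {τ π : List ℕ} → τ ⊆ π → suc (length τ) ≡ length π →
             ∃[ xs ] ∃[ y ] ∃[ ys ] (π ≡ xs ++ y ∷ ys × τ ≡ xs ++ ys)
⊆-drop-one (y ∷ʳ τ⊆π) eq = [] , y , _ , refl , Pointwise-≡⇒≡ (to-≋ (suc-injective eq) τ⊆π)
⊆-drop-one (refl ∷ τ⊆π) eq with ⊆-drop-one τ⊆π (suc-injective eq)
... | xs , y , ys , refl , refl = _ ∷ xs , y , ys , refl , refl

shadow⇔deletion : ∀ {n π σ} → IsPerm (suc n) π → InShadow n π σ ⇔ IsDeletion π σ
shadow⇔deletion {n} {π} {σ} π↭ = mk⇔ shadow⇒deletion deletion⇒shadow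
  where
  deletion⇒shadow : IsDeletion π σ → InShadow n π σ
  deletion⇒shadow (v , v∈π , refl) =
    delete-perm π↭ v∈π , filter (_≢? v) π , filter-⊆ (_≢? v) π , OrdIso-delete v π

  shadow⇒deletion : InShadow n π σ → IsDeletion π σ
  shadow⇒deletion (σ↭ , τ , τ⊆π , iso) with ⊆-drop-one τ⊆π (begin
    suc (length τ)   ≡⟨ cong suc (OrdIso-length σ τ iso) ⟨
    suc (length σ)   ≡⟨ cong suc (perm-length σ↭) ⟩
    suc n            ≡⟨ perm-length π↭ ⟨
    length π         ∎)
    where open ≡-Reasoning
  ... | xs , y , ys , refl , refl = y , y∈π , OrdIso-perm-unique σ↭ (delete-perm π↭ y∈π) σ≅deletion
    where
    y∈π : y ∈ xs ++ y ∷ ys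
    y∈π = ∈-++⁺ʳ xs (here refl)
    σ≅deletion : OrdIso σ (delete y (xs ++ y ∷ ys))
    σ≅deletion = OrdIso-trans σ (xs ++ ys) _ iso (OrdIso-sym _ _
      (subst (OrdIso (delete y (xs ++ y ∷ ys))) (filter-≢-middle xs (perm-unique π↭)) (OrdIso-delete y (xs ++ y ∷ ys))))

ShadowIsPair : ℕ → List ℕ → List ℕ → List ℕ → Set
ShadowIsPair n π m b = (σ : List ℕ) → InShadow n π σ ⇔ (σ ≡ m ⊎ σ ≡ b)

DeletionsArePair : List ℕ → List ℕ → List ℕ → Set
DeletionsArePair π m b =
  (∀ {v} → v ∈ π → delete v π ≡ m ⊎ delete v π ≡ b) × IsDeletion π m × IsDeletion π b

ShadowIsPair⇔DeletionsArePair : ∀ {n π m b} → IsPerm (suc n) π → ShadowIsPair n π m b ⇔ DeletionsArePair π m b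
ShadowIsPair⇔DeletionsArePair {n} {π} {m} {b} π↭ = mk⇔ into onto
  where
  shadow⇔ : ∀ {σ} → InShadow n π σ ⇔ IsDeletion π σ
  shadow⇔ = shadow⇔deletion π↭
  into : ShadowIsPair n π m b → DeletionsArePair π m b
  into sh = (λ v∈ → to (sh _) (from shadow⇔ (_ , v∈ , refl)))
          , to shadow⇔ (from (sh m) (inj₁ refl)) , to shadow⇔ (from (sh b) (inj₂ refl))
  onto : DeletionsArePair π m b → ShadowIsPair n π m b
  onto (deletions , m∈ , b∈) σ = mk⇔ classify realise
    where
    realise : σ ≡ m ⊎ σ ≡ b → InShadow n π σ
    realise (inj₁ refl) = from shadow⇔ m∈
    realise (inj₂ refl) = from shadow⇔ b∈
    classify : InShadow n π σ → σ ≡ m ⊎ σ ≡ b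
    classify σ∈ with to shadow⇔ σ∈
    ... | v , v∈ , refl = deletions v∈

DeletionsArePair⇒ShadowIsPair : ∀ {n π m b} → IsPerm (suc n) π → DeletionsArePair π m b → ShadowIsPair n π m b
DeletionsArePair⇒ShadowIsPair π↭ = from (ShadowIsPair⇔DeletionsArePair π↭)

DeletionsArePair-cast : ∀ {π π′ m m′ b b′} → π ≡ π′ → m ≡ m′ → b ≡ b′ →
                        DeletionsArePair π m b → DeletionsArePair π′ m′ b′
DeletionsArePair-cast refl refl refl pair = pair

distinct-deletions : ∀ {π m b σ σ′} → IsDeletion π σ → IsDeletion π σ′ →
                     σ ≢ m → σ′ ≢ m → σ ≢ σ′ → ¬ DeletionsArePair π m b
distinct-deletions (v , v∈ , refl) (v′ , v′∈ , refl) σ≢m σ′≢m σ≢σ′ (deletions , _)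
  with deletions v∈ | deletions v′∈
... | inj₁ σ≡m | _         = σ≢m σ≡m
... | inj₂ _   | inj₁ σ′≡m = σ′≢m σ′≡m
... | inj₂ σ≡b | inj₂ σ′≡b = σ≢σ′ (trans σ≡b (sym σ′≡b))

-- Complement

map-∸-upFrom : ∀ c a b m → a + m + b ≡ suc c → map (c ∸_) (upFrom a m) ≡ reverse (upFrom b m)
map-∸-upFrom c a b zero    _  = refl
map-∸-upFrom c a b (suc m) eq = begin
  c ∸ a ∷ map (c ∸_) (upFrom (suc a) m)   ≡⟨ cong₂ _∷_ head (map-∸-upFrom c (suc a) b m eq′) ⟩
  b + m ∷ reverse (upFrom b m)             ≡⟨ reverse-upFrom-suc b m ⟨
  reverse (upFrom b (suc m))               ∎
  where
  open ≡-Reasoning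
  eq′ : suc a + m + b ≡ suc c
  eq′ = trans (cong (_+ b) (sym (+-suc a m))) eq
  head : c ∸ a ≡ b + m
  head = begin
    c ∸ a             ≡⟨ cong (_∸ a) (suc-injective (trans (sym eq) (cong (_+ b) (+-suc a m)))) ⟩
    a + m + b ∸ a     ≡⟨ cong (_∸ a) (+-assoc a m b) ⟩
    a + (m + b) ∸ a   ≡⟨ m+n∸m≡n a (m + b) ⟩
    m + b             ≡⟨ +-comm m b ⟩
    b + m             ∎

comp-range : ∀ k → comp k (range 1 k) ≡ reverse (range 1 k)
comp-range k = begin
  comp k (range 1 k)              ≡⟨ cong (comp k) (range≡upFrom 1 k) ⟩
  map (suc k ∸_) (upFrom 1 k)     ≡⟨ map-∸-upFrom (suc k) 1 1 k (cong suc (+-comm k 1)) ⟩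
  reverse (upFrom 1 k)            ≡⟨ cong reverse (sym (range≡upFrom 1 k)) ⟩
  reverse (range 1 k)             ∎
  where open ≡-Reasoning

comp-reverse-range : ∀ k → comp k (reverse (range 1 k)) ≡ range 1 k
comp-reverse-range k = begin
  comp k (reverse (range 1 k))    ≡⟨ reverse-map (suc k ∸_) (range 1 k) ⟩
  reverse (comp k (range 1 k))    ≡⟨ cong reverse (comp-range k) ⟩
  reverse (reverse (range 1 k))   ≡⟨ reverse-involutive (range 1 k) ⟩
  range 1 k                       ∎
  where open ≡-Reasoning

Monotone-comp : ∀ {n m} → Monotone n m → Monotone n (comp n m)
Monotone-comp {n} (inj₁ refl) = inj₂ (comp-range n)
Monotone-comp {n} (inj₂ refl) = inj₁ (comp-reverse-range n)

comp-perm : ∀ {k w} → IsPerm k w → IsPerm k (comp k w)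
comp-perm {k} w↭ =
  ↭-trans (map⁺ (suc k ∸_) w↭) (subst (_↭ range 1 k) (sym (comp-range k)) (↭-reverse (range 1 k)))

comp-inRange : ∀ {k x} → InRange k x → InRange k (suc k ∸ x)
comp-inRange {k} {suc x} (_ , x<k) = m<n⇒0<n∸m x<k , m∸n≤m k x

comp-inRange⁻ : ∀ {k x} → InRange k (suc k ∸ x) → InRange k x
comp-inRange⁻ {k} {zero}  (_ , 1+k≤k) = ⊥-elim (1+n≰n 1+k≤k)
comp-inRange⁻ {k} {suc x} (1≤k∸x , _) =
  s≤s z≤n , ≮⇒≥ λ k<1+x → <⇒≱ 1≤k∸x (≤-reflexive (m≤n⇒m∸n≡0 (≤-pred k<1+x)))

comp-involutive : ∀ {k w} → All (InRange k) w → comp k (comp k w) ≡ w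
comp-involutive {k} {w} w∈ =
  trans (sym (map-∘ w)) (map-id-local (All.map (λ (_ , x≤k) → m∸[m∸n]≡n (m≤n⇒m≤1+n x≤k)) w∈))

comp-involutive⁻ : ∀ {k w} → All (InRange k) (comp k w) → comp k (comp k w) ≡ w
comp-involutive⁻ wᶜ∈ = comp-involutive (All.map comp-inRange⁻ (All.map⁻ wᶜ∈))

comp-perm⁻ : ∀ {k w} → IsPerm k (comp k w) → IsPerm k w
comp-perm⁻ {k} wᶜ↭ = subst (IsPerm k) (comp-involutive⁻ (perm-inRange wᶜ↭)) (comp-perm wᶜ↭)

comp-antitone : ∀ {k a b} → InRange k a → InRange k b → a < b ⇔ suc k ∸ b < suc k ∸ a
comp-antitone {k} {a} {b} _ (_ , b≤k) = mk⇔ (λ a<b → ∸-monoʳ-< a<b (m≤n⇒m≤1+n b≤k)) reflect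
  where
  reflect : suc k ∸ b < suc k ∸ a → a < b
  reflect k∸b<k∸a = ≮⇒≥ (λ b<1+a → <⇒≱ k∸b<k∸a (∸-monoʳ-≤ (suc k) (≤-pred b<1+a)))

shadow-comp : ∀ {n π σ} → All (InRange (suc n)) π → InShadow n π σ → InShadow n (comp (suc n) π) (comp n σ)
shadow-comp {n} π∈ (σ↭ , τ , τ⊆π , iso) =
  comp-perm σ↭ , map (suc (suc n) ∸_) τ , Sublist.map⁺ (suc (suc n) ∸_) τ⊆π ,
  OrdIso-map-antitone comp-antitone comp-antitone (perm-inRange σ↭) (All-resp-⊆ τ⊆π π∈) iso

ShadowIsPair-comp : ∀ {n π m b} → All (InRange (suc n)) π → ShadowIsPair n π m b →
                    ShadowIsPair n (comp (suc n) π) (comp n m) (comp n b)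
ShadowIsPair-comp {n} {π} {m} {b} π∈ shadow σ = mk⇔ into onto
  where
  into : InShadow n (comp (suc n) π) σ → σ ≡ comp n m ⊎ σ ≡ comp n b
  into σ∈ with to (shadow (comp n σ)) (subst (λ w → InShadow n w (comp n σ)) (comp-involutive π∈)
                                             (shadow-comp (All.map⁺ (All.map comp-inRange π∈)) σ∈))
  ... | inj₁ σᶜ≡m = inj₁ (trans (sym (comp-involutive (perm-inRange (proj₁ σ∈)))) (cong (comp n) σᶜ≡m))
  ... | inj₂ σᶜ≡b = inj₂ (trans (sym (comp-involutive (perm-inRange (proj₁ σ∈)))) (cong (comp n) σᶜ≡b))
  onto : σ ≡ comp n m ⊎ σ ≡ comp n b → InShadow n (comp (suc n) π) σ
  onto (inj₁ refl) = shadow-comp π∈ (from (shadow m) (inj₁ refl))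
  onto (inj₂ refl) = shadow-comp π∈ (from (shadow b) (inj₂ refl))

DeletionsArePair⇒ShadowIsPair-comp : ∀ {n π m b} → IsPerm (suc n) (comp (suc n) π) → DeletionsArePair π m b →
                                     ShadowIsPair n (comp (suc n) π) (comp n m) (comp n b)
DeletionsArePair⇒ShadowIsPair-comp πᶜ↭ pair =
  ShadowIsPair-comp (perm-inRange (comp-perm⁻ πᶜ↭)) (DeletionsArePair⇒ShadowIsPair (comp-perm⁻ πᶜ↭) pair)

-- The identity with one entry moved

data Direction : Set where
  leftward rightward : Direction

rotation : Direction → ℕ → ℕ → List ℕ
rotation leftward  c e = c + e ∷ upFrom c e
rotation rightward c e = upFrom (suc c) e ++ [ c ]

movedEntry : Direction → ℕ → ℕ → ℕ
movedEntry leftward  c e = c + e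
movedEntry rightward c e = c

-- The identity of length ℓ + (e + 1) + z with the last (leftward) or first (rightward) entry of the block
-- ℓ + 1, …, ℓ + e + 1 moved to the other end of the block; e = 0 gives the identity itself.
oneMove : Direction → ℕ → ℕ → ℕ → List ℕ
oneMove d ℓ e z = upFrom 1 ℓ ++ rotation d (suc ℓ) e ++ upFrom (suc ℓ + suc e) z

rotation-↭ : ∀ d c e → rotation d c e ↭ upFrom c (suc e)
rotation-↭ leftward  c e = subst (c + e ∷ upFrom c e ↭_) (sym (upFrom-∷ʳ c e)) (∷↭∷ʳ (c + e) (upFrom c e))
rotation-↭ rightward c e = ↭-sym (∷↭∷ʳ c (upFrom (suc c) e))

rotation-lower : ∀ d c e → All (c ≤_) (rotation d c e)
rotation-lower d c e = All-resp-↭ (↭-sym (rotation-↭ d c e)) (upFrom-lower c (suc e))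

rotation-upper : ∀ d c e → All (_< c + suc e) (rotation d c e)
rotation-upper d c e = All-resp-↭ (↭-sym (rotation-↭ d c e)) (upFrom-upper c (suc e))

rotation-suc : ∀ d c e → rotation d (suc c) e ≡ map suc (rotation d c e)
rotation-suc leftward  c e = cong (suc (c + e) ∷_) (sym (map-suc-upFrom c e))
rotation-suc rightward c e =
  trans (cong (_++ [ suc c ]) (sym (map-suc-upFrom (suc c) e))) (sym (map-++ suc (upFrom (suc c) e) [ c ]))

rotation-zero : ∀ d c → rotation d c 0 ≡ [ c ]
rotation-zero leftward  c = cong [_] (+-identityʳ c)
rotation-zero rightward c = refl

rotation-zero-moved : ∀ d c {v} → v ∈ rotation d c 0 → v ≡ movedEntry d c 0
rotation-zero-moved leftward  c (here v≡c+0) = v≡c+0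
rotation-zero-moved rightward c (here v≡c)   = v≡c

movedEntry-∈ : ∀ d c e → movedEntry d c e ∈ rotation d c e
movedEntry-∈ leftward  c e = here refl
movedEntry-∈ rightward c e = ∈-++⁺ʳ (upFrom (suc c) e) (here refl)

fixedEntry : ∀ d c e → ∃[ v ] (v ∈ rotation d c (suc e) × v ≢ movedEntry d c (suc e))
fixedEntry leftward  c e = c , there (here refl) , <⇒≢ (m<m+n c (s≤s z≤n))
fixedEntry rightward c e = suc c , here refl , 1+n≢n

delete-rotation-moved : ∀ d c e → delete (movedEntry d c e) (rotation d c e) ≡ upFrom c e
delete-rotation-moved leftward  c e = trans (delete-∷-self (c + e) (upFrom c e)) (delete-below (upFrom-upper c e))
delete-rotation-moved rightward c e = begin
  delete c (upFrom (suc c) e ++ [ c ])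
    ≡⟨ delete-++ c (upFrom (suc c) e) [ c ] ⟩
  delete c (upFrom (suc c) e) ++ delete c [ c ]
    ≡⟨ cong₂ _++_ (cong (delete c) (sym (map-suc-upFrom c e))) (delete-∷-self c []) ⟩
  delete c (map suc (upFrom c e)) ++ []
    ≡⟨ trans (++-identityʳ _) (delete-above (upFrom-lower c e)) ⟩
  upFrom c e
    ∎
  where open ≡-Reasoning

delete-rotation-fixed : ∀ d c e {v} → v ∈ rotation d c (suc e) → v ≢ movedEntry d c (suc e) →
                        delete v (rotation d c (suc e)) ≡ rotation d c e
delete-rotation-fixed leftward c e (here refl)  v≢moved = ⊥-elim (v≢moved refl)
delete-rotation-fixed leftward c e (there v∈)  _        =
  trans (delete-∷-above (upFrom c (suc e)) (proj₂ (∈-upFrom⁻ c (suc e) v∈)))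
        (cong₂ _∷_ (cong pred (+-suc c e)) (delete-upFrom c e v∈))
delete-rotation-fixed rightward c e {v} v∈ v≢moved with ∈-++⁻ (upFrom (suc c) (suc e)) v∈
... | inj₂ (here refl) = ⊥-elim (v≢moved refl)
... | inj₁ v∈run       =
  trans (delete-++ v (upFrom (suc c) (suc e)) [ c ])
        (cong₂ _++_ (delete-upFrom (suc c) e v∈run) (delete-below (proj₁ (∈-upFrom⁻ (suc c) (suc e) v∈run) ∷ [])))

oneMove-zero : ∀ d ℓ z → oneMove d ℓ 0 z ≡ upFrom 1 (ℓ + suc z)
oneMove-zero d ℓ z = begin
  upFrom 1 ℓ ++ rotation d (suc ℓ) 0 ++ upFrom (suc ℓ + 1) z
    ≡⟨ cong₂ (λ r c → upFrom 1 ℓ ++ r ++ upFrom c z) (rotation-zero d (suc ℓ)) (+-comm (suc ℓ) 1) ⟩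
  upFrom 1 ℓ ++ upFrom (suc ℓ) (suc z)
    ≡⟨ upFrom-++ 1 ℓ (suc z) ⟨
  upFrom 1 (ℓ + suc z)
    ∎
  where open ≡-Reasoning

oneMove-transposition : ∀ d ℓ z → oneMove d ℓ 1 z ≡ oneMove rightward ℓ 1 z
oneMove-transposition leftward  ℓ z =
  cong (λ c → upFrom 1 ℓ ++ c ∷ suc ℓ ∷ upFrom (suc ℓ + 2) z) (+-comm (suc ℓ) 1)
oneMove-transposition rightward ℓ z = refl

length-oneMove : ∀ d ℓ e z → length (oneMove d ℓ e z) ≡ ℓ + (suc e + z)
length-oneMove d ℓ e z = begin
  length (upFrom 1 ℓ ++ rotation d (suc ℓ) e ++ upFrom (suc ℓ + suc e) z)
    ≡⟨ length-++ (upFrom 1 ℓ) ⟩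
  length (upFrom 1 ℓ) + length (rotation d (suc ℓ) e ++ upFrom (suc ℓ + suc e) z)
    ≡⟨ cong₂ _+_ (length-upFrom 1 ℓ) (length-++ (rotation d (suc ℓ) e)) ⟩
  ℓ + (length (rotation d (suc ℓ) e) + length (upFrom (suc ℓ + suc e) z))
    ≡⟨ cong₂ (λ r u → ℓ + (r + u)) (trans (↭-length (rotation-↭ d (suc ℓ) e)) (length-upFrom (suc ℓ) (suc e)))
                                   (length-upFrom _ z) ⟩
  ℓ + (suc e + z)
    ∎
  where open ≡-Reasoning

delete-oneMove-first : ∀ d ℓ e z {v} → v ∈ upFrom 1 (suc ℓ) →
                       delete v (oneMove d (suc ℓ) e z) ≡ oneMove d ℓ e z
delete-oneMove-first d ℓ e z {v} v∈ = begin
  delete v (upFrom 1 (suc ℓ) ++ rotation d (suc (suc ℓ)) e ++ upFrom (suc (suc ℓ) + suc e) z)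
    ≡⟨ cong (λ ws → delete v (upFrom 1 (suc ℓ) ++ ws)) shifted ⟩
  delete v ([] ++ upFrom 1 (suc ℓ) ++ map suc rest)
    ≡⟨ delete-between [] (upFrom 1 (suc ℓ)) rest [] v≤rest ⟩
  delete v (upFrom 1 (suc ℓ)) ++ rest
    ≡⟨ cong (_++ rest) (delete-upFrom 1 ℓ v∈) ⟩
  upFrom 1 ℓ ++ rest
    ∎
  where
  open ≡-Reasoning
  rest : List ℕ
  rest = rotation d (suc ℓ) e ++ upFrom (suc ℓ + suc e) z
  shifted : rotation d (suc (suc ℓ)) e ++ upFrom (suc (suc ℓ) + suc e) z ≡ map suc rest
  shifted = trans (cong₂ _++_ (rotation-suc d (suc ℓ) e) (sym (map-suc-upFrom (suc ℓ + suc e) z)))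
                  (sym (map-++ suc (rotation d (suc ℓ) e) _))
  v≤1+ℓ : v ≤ suc ℓ
  v≤1+ℓ = ≤-pred (proj₂ (∈-upFrom⁻ 1 (suc ℓ) v∈))
  v≤rest : All (v ≤_) rest
  v≤rest = All.++⁺ (All.map (≤-trans v≤1+ℓ) (rotation-lower d (suc ℓ) e))
                   (All.map (≤-trans (≤-trans v≤1+ℓ (m≤m+n (suc ℓ) (suc e)))) (upFrom-lower (suc ℓ + suc e) z))

delete-oneMove-last : ∀ d ℓ e z {v} → v ∈ upFrom (suc ℓ + suc e) (suc z) →
                      delete v (oneMove d ℓ e (suc z)) ≡ oneMove d ℓ e z
delete-oneMove-last d ℓ e z {v} v∈ = begin
  delete v (upFrom 1 ℓ ++ rotation d (suc ℓ) e ++ upFrom (suc ℓ + suc e) (suc z))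
    ≡⟨ delete-++ v (upFrom 1 ℓ) _ ⟩
  delete v (upFrom 1 ℓ) ++ delete v (rotation d (suc ℓ) e ++ upFrom (suc ℓ + suc e) (suc z))
    ≡⟨ cong₂ _++_ (delete-below (All.map (λ x<1+ℓ → <-≤-trans x<1+ℓ 1+ℓ≤v) (upFrom-upper 1 ℓ)))
                  (delete-++ v (rotation d (suc ℓ) e) _) ⟩
  upFrom 1 ℓ ++ delete v (rotation d (suc ℓ) e) ++ delete v (upFrom (suc ℓ + suc e) (suc z))
    ≡⟨ cong₂ (λ r u → upFrom 1 ℓ ++ r ++ u)
             (delete-below (All.map (λ x<L → <-≤-trans x<L L≤v) (rotation-upper d (suc ℓ) e)))
             (delete-upFrom (suc ℓ + suc e) z v∈) ⟩
  upFrom 1 ℓ ++ rotation d (suc ℓ) e ++ upFrom (suc ℓ + suc e) z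
    ∎
  where
  open ≡-Reasoning
  L≤v : suc ℓ + suc e ≤ v
  L≤v = proj₁ (∈-upFrom⁻ (suc ℓ + suc e) (suc z) v∈)
  1+ℓ≤v : suc ℓ ≤ v
  1+ℓ≤v = ≤-trans (m≤m+n (suc ℓ) (suc e)) L≤v

delete-oneMove-rotation : ∀ d ℓ e z {v} → v ∈ rotation d (suc ℓ) e →
  delete v (oneMove d ℓ e z) ≡ upFrom 1 ℓ ++ delete v (rotation d (suc ℓ) e) ++ upFrom (suc ℓ + e) z
delete-oneMove-rotation d ℓ e z {v} v∈ = begin
  delete v (upFrom 1 ℓ ++ rotation d (suc ℓ) e ++ upFrom (suc ℓ + suc e) z)
    ≡⟨ cong (λ c → delete v (upFrom 1 ℓ ++ rotation d (suc ℓ) e ++ upFrom c z)) (+-suc (suc ℓ) e) ⟩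
  delete v (upFrom 1 ℓ ++ rotation d (suc ℓ) e ++ upFrom (suc (suc ℓ + e)) z)
    ≡⟨ cong (λ u → delete v (upFrom 1 ℓ ++ rotation d (suc ℓ) e ++ u)) (sym (map-suc-upFrom (suc ℓ + e) z)) ⟩
  delete v (upFrom 1 ℓ ++ rotation d (suc ℓ) e ++ map suc (upFrom (suc ℓ + e) z))
    ≡⟨ delete-between (upFrom 1 ℓ) (rotation d (suc ℓ) e) _ ℓ<v v≤last ⟩
  upFrom 1 ℓ ++ delete v (rotation d (suc ℓ) e) ++ upFrom (suc ℓ + e) z
    ∎
  where
  open ≡-Reasoning
  ℓ<v : All (_< v) (upFrom 1 ℓ)
  ℓ<v = All.map (λ x<1+ℓ → <-≤-trans x<1+ℓ (All.lookup (rotation-lower d (suc ℓ) e) v∈)) (upFrom-upper 1 ℓ)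
  v≤last : All (v ≤_) (upFrom (suc ℓ + e) z)
  v≤last = All.map (≤-trans (≤-pred (subst (v <_) (+-suc (suc ℓ) e) (All.lookup (rotation-upper d (suc ℓ) e) v∈))))
                   (upFrom-lower (suc ℓ + e) z)

delete-oneMove-moved : ∀ d ℓ e z → delete (movedEntry d (suc ℓ) e) (oneMove d ℓ e z) ≡ upFrom 1 (ℓ + (e + z))
delete-oneMove-moved d ℓ e z = begin
  delete (movedEntry d (suc ℓ) e) (oneMove d ℓ e z)
    ≡⟨ delete-oneMove-rotation d ℓ e z (movedEntry-∈ d (suc ℓ) e) ⟩
  upFrom 1 ℓ ++ delete (movedEntry d (suc ℓ) e) (rotation d (suc ℓ) e) ++ upFrom (suc ℓ + e) z
    ≡⟨ cong (λ r → upFrom 1 ℓ ++ r ++ upFrom (suc ℓ + e) z) (delete-rotation-moved d (suc ℓ) e) ⟩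
  upFrom 1 ℓ ++ upFrom (suc ℓ) e ++ upFrom (suc ℓ + e) z
    ≡⟨ cong (upFrom 1 ℓ ++_) (upFrom-++ (suc ℓ) e z) ⟨
  upFrom 1 ℓ ++ upFrom (suc ℓ) (e + z)
    ≡⟨ upFrom-++ 1 ℓ (e + z) ⟨
  upFrom 1 (ℓ + (e + z))
    ∎
  where open ≡-Reasoning

delete-oneMove-fixed : ∀ d ℓ e z {v} → v ∈ rotation d (suc ℓ) (suc e) → v ≢ movedEntry d (suc ℓ) (suc e) →
                       delete v (oneMove d ℓ (suc e) z) ≡ oneMove d ℓ e z
delete-oneMove-fixed d ℓ e z v∈ v≢moved =
  trans (delete-oneMove-rotation d ℓ (suc e) z v∈)
        (cong (λ r → upFrom 1 ℓ ++ r ++ upFrom (suc ℓ + suc e) z) (delete-rotation-fixed d (suc ℓ) e v∈ v≢moved))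

delete-oneMove : ∀ d ℓ e z {v} → v ∈ oneMove d ℓ e z →
    delete v (oneMove d ℓ e z) ≡ upFrom 1 (ℓ + (e + z))
  ⊎ ∃[ ℓ′ ] (ℓ ≡ suc ℓ′ × delete v (oneMove d ℓ e z) ≡ oneMove d ℓ′ e z)
  ⊎ ∃[ e′ ] (e ≡ suc e′ × delete v (oneMove d ℓ e z) ≡ oneMove d ℓ e′ z)
  ⊎ ∃[ z′ ] (z ≡ suc z′ × delete v (oneMove d ℓ e z) ≡ oneMove d ℓ e z′)
delete-oneMove d ℓ e z {v} v∈ with ∈-++⁻ (upFrom 1 ℓ) v∈
delete-oneMove d (suc ℓ) e z v∈ | inj₁ v∈first = inj₂ (inj₁ (ℓ , refl , delete-oneMove-first d ℓ e z v∈first))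
delete-oneMove d ℓ e z {v} v∈ | inj₂ v∈rest with ∈-++⁻ (rotation d (suc ℓ) e) v∈rest
delete-oneMove d ℓ e (suc z) v∈ | inj₂ _ | inj₂ v∈last =
  inj₂ (inj₂ (inj₂ (z , refl , delete-oneMove-last d ℓ e z v∈last)))
delete-oneMove d ℓ e z {v} v∈ | inj₂ _ | inj₁ v∈rot with v ≟ movedEntry d (suc ℓ) e
... | yes refl = inj₁ (delete-oneMove-moved d ℓ e z)
delete-oneMove d ℓ zero    z v∈ | inj₂ _ | inj₁ v∈rot | no v≢moved =
  ⊥-elim (v≢moved (rotation-zero-moved d (suc ℓ) v∈rot))
delete-oneMove d ℓ (suc e) z v∈ | inj₂ _ | inj₁ v∈rot | no v≢moved =
  inj₂ (inj₂ (inj₁ (e , refl , delete-oneMove-fixed d ℓ e z v∈rot v≢moved)))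

movedEntry-∈-oneMove : ∀ d ℓ e z → movedEntry d (suc ℓ) e ∈ oneMove d ℓ e z
movedEntry-∈-oneMove d ℓ e z = ∈-++⁺ʳ (upFrom 1 ℓ) (∈-++⁺ˡ (movedEntry-∈ d (suc ℓ) e))

IsDeletion-moved : ∀ d ℓ e z → IsDeletion (oneMove d ℓ e z) (upFrom 1 (ℓ + (e + z)))
IsDeletion-moved d ℓ e z = movedEntry d (suc ℓ) e , movedEntry-∈-oneMove d ℓ e z , sym (delete-oneMove-moved d ℓ e z)

IsDeletion-first : ∀ d ℓ e z → IsDeletion (oneMove d (suc ℓ) e z) (oneMove d ℓ e z)
IsDeletion-first d ℓ e z = 1 , here refl , sym (delete-oneMove-first d ℓ e z (here refl))

IsDeletion-last : ∀ d ℓ e z → IsDeletion (oneMove d ℓ e (suc z)) (oneMove d ℓ e z)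
IsDeletion-last d ℓ e z = suc ℓ + suc e , ∈-++⁺ʳ (upFrom 1 ℓ) (∈-++⁺ʳ (rotation d (suc ℓ) e) (here refl)) ,
                          sym (delete-oneMove-last d ℓ e z (here refl))

IsDeletion-fixed : ∀ d ℓ e z → IsDeletion (oneMove d ℓ (suc e) z) (oneMove d ℓ e z)
IsDeletion-fixed d ℓ e z with fixedEntry d (suc ℓ) e
... | v , v∈ , v≢moved = v , ∈-++⁺ʳ (upFrom 1 ℓ) (∈-++⁺ˡ v∈) , sym (delete-oneMove-fixed d ℓ e z v∈ v≢moved)

run-oneMove : ∀ d ℓ e z → run 1 (oneMove d ℓ (suc e) z) ≡ ℓ
run-oneMove leftward  ℓ e z = run-upFrom-++ 1 ℓ (m+1+n≢m (suc ℓ))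
run-oneMove rightward ℓ e z = run-upFrom-++ 1 ℓ 1+n≢n

oneMove≢upFrom : ∀ d ℓ e z n → oneMove d ℓ (suc e) z ≢ upFrom 1 n
oneMove≢upFrom d ℓ e z n eq = m+1+n≢m ℓ (begin
  ℓ + (suc (suc e) + z)               ≡⟨ length-oneMove d ℓ (suc e) z ⟨
  length (oneMove d ℓ (suc e) z)      ≡⟨ cong length eq ⟩
  length (upFrom 1 n)                 ≡⟨ length-upFrom 1 n ⟩
  n                                   ≡⟨ run-upFrom 1 n ⟨
  run 1 (upFrom 1 n)                  ≡⟨ cong (run 1) eq ⟨
  run 1 (oneMove d ℓ (suc e) z)       ≡⟨ run-oneMove d ℓ e z ⟩
  ℓ                                   ∎)
  where open ≡-Reasoning

rotation-++-injective : ∀ d c {e e′ xs ys} → rotation d c (suc e) ++ xs ≡ rotation d c (suc e′) ++ ys → e ≡ e′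
rotation-++-injective leftward  c eq = suc-injective (+-cancelˡ-≡ c _ _ (∷-injectiveˡ eq))
rotation-++-injective rightward c {e} {e′} {xs} {ys} eq = suc-injective (begin
  suc e                                                   ≡⟨ run-upFrom-++ (suc c) (suc e) (<⇒≢ (s≤s (m≤m+n c (suc e)))) ⟨
  run (suc c) (upFrom (suc c) (suc e) ++ c ∷ xs)          ≡⟨ cong (run (suc c)) (++-assoc (upFrom (suc c) (suc e)) _ xs) ⟨
  run (suc c) ((upFrom (suc c) (suc e) ++ [ c ]) ++ xs)   ≡⟨ cong (run (suc c)) eq ⟩
  run (suc c) ((upFrom (suc c) (suc e′) ++ [ c ]) ++ ys)  ≡⟨ cong (run (suc c)) (++-assoc (upFrom (suc c) (suc e′)) _ ys) ⟩
  run (suc c) (upFrom (suc c) (suc e′) ++ c ∷ ys)         ≡⟨ run-upFrom-++ (suc c) (suc e′) (<⇒≢ (s≤s (m≤m+n c (suc e′)))) ⟩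
  suc e′                                                  ∎)
  where open ≡-Reasoning

oneMove-injective : ∀ d {ℓ ℓ′ e e′ z z′} → oneMove d ℓ (suc e) z ≡ oneMove d ℓ′ (suc e′) z′ →
                    ℓ ≡ ℓ′ × e ≡ e′
oneMove-injective d {ℓ} {ℓ′} {e} {e′} {z} {z′} eq
  with trans (sym (run-oneMove d ℓ e z)) (trans (cong (run 1) eq) (run-oneMove d ℓ′ e′ z′))
... | refl = refl , rotation-++-injective d (suc ℓ) (++-cancelˡ (upFrom 1 ℓ) _ _ eq)

reduce-preimage : ∀ w z {xs} → All (_≢ suc w) xs → map (reduce (suc w)) xs ≡ upFrom 1 (w + z) →
                  xs ≡ upFrom 1 w ++ upFrom (2 + w) z
reduce-preimage w z {xs} xs≢v eq =
  trans (map-injectiveOn reduce-injective xs≢v ≢v (trans eq (sym reduces)))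
        (cong (upFrom 1 w ++_) (map-suc-upFrom (suc w) z))
  where
  open ≡-Reasoning
  target : List ℕ
  target = upFrom 1 w ++ map suc (upFrom (suc w) z)
  ≢v : All (_≢ suc w) target
  ≢v = All.++⁺ (All.map <⇒≢ (upFrom-upper 1 w)) (All.map⁺ (All.map (>⇒≢ ∘ s≤s) (upFrom-lower (suc w) z)))
  reduces : map (reduce (suc w)) target ≡ upFrom 1 (w + z)
  reduces = begin
    map (reduce (suc w)) target                      ≡⟨ cong (map (reduce (suc w))) (filter-all (_≢? suc w) ≢v) ⟨
    delete (suc w) ([] ++ target)
      ≡⟨ delete-between (upFrom 1 w) [] (upFrom (suc w) z) (upFrom-upper 1 w) (upFrom-lower (suc w) z) ⟩
    upFrom 1 w ++ upFrom (suc w) z                   ≡⟨ upFrom-++ 1 w z ⟨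
    upFrom 1 (w + z)                                 ∎

reinsert-oneMove : ∀ w z xs ys → xs ++ ys ≡ upFrom 1 w ++ upFrom (2 + w) z →
                   ∃[ d ] ∃[ ℓ ] ∃[ e ] ∃[ z′ ] (xs ++ suc w ∷ ys ≡ oneMove d ℓ e z′)
reinsert-oneMove w z xs ys eq with ≤-total (length xs) w
... | inj₁ xs≤w
  with ++-split-≤ (upFrom 1 w) (upFrom (2 + w) z) xs ys (sym eq) (subst (length xs ≤_) (sym (length-upFrom 1 w)) xs≤w)
...   | ws , prefix≡ , refl with upFrom-++⁻ 1 xs ws (sym prefix≡)
            | trans (sym (length-upFrom 1 w)) (trans (cong length prefix≡) (length-++ xs))
...     | xs≡ , ws≡ | refl = leftward , length xs , length ws , z , (begin
  xs ++ suc w ∷ ws ++ upFrom (2 + w) z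
    ≡⟨ cong₂ (λ p q → p ++ suc w ∷ q ++ upFrom (2 + w) z) xs≡ ws≡ ⟩
  upFrom 1 (length xs) ++ suc w ∷ upFrom (suc (length xs)) (length ws) ++ upFrom (2 + w) z
    ≡⟨ cong (λ c → upFrom 1 (length xs) ++ suc w ∷ upFrom (suc (length xs)) (length ws) ++ upFrom c z)
            (cong suc (sym (+-suc (length xs) (length ws)))) ⟩
  oneMove leftward (length xs) (length ws) z
    ∎)
  where open ≡-Reasoning
reinsert-oneMove w z xs ys eq | inj₂ w≤xs
  with ++-split-≤ xs ys (upFrom 1 w) (upFrom (2 + w) z) eq (subst (_≤ length xs) (sym (length-upFrom 1 w)) w≤xs)
...   | ws , refl , suffix≡ with upFrom-++⁻ (2 + w) ws ys (sym suffix≡)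
...     | ws≡ , ys≡ = rightward , w , length ws , length ys , (begin
  (upFrom 1 w ++ ws) ++ suc w ∷ ys
    ≡⟨ ++-assoc (upFrom 1 w) ws _ ⟩
  upFrom 1 w ++ ws ++ suc w ∷ ys
    ≡⟨ cong (upFrom 1 w ++_) (sym (++-assoc ws [ suc w ] ys)) ⟩
  upFrom 1 w ++ (ws ++ [ suc w ]) ++ ys
    ≡⟨ cong₂ (λ p q → upFrom 1 w ++ (p ++ [ suc w ]) ++ q) ws≡ ys≡ ⟩
  upFrom 1 w ++ (upFrom (2 + w) (length ws) ++ [ suc w ]) ++ upFrom (2 + w + length ws) (length ys)
    ≡⟨ cong (λ c → upFrom 1 w ++ (upFrom (2 + w) (length ws) ++ [ suc w ]) ++ upFrom c (length ys))
            (cong suc (sym (+-suc w (length ws)))) ⟩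
  oneMove rightward w (length ws) (length ys)
    ∎)
  where open ≡-Reasoning

delete≡identity⇒oneMove : ∀ {n π v} → IsPerm (suc n) π → v ∈ π → delete v π ≡ upFrom 1 n →
                          ∃[ d ] ∃[ ℓ ] ∃[ e ] ∃[ z ] (π ≡ oneMove d ℓ e z)
delete≡identity⇒oneMove {n} {π} {v} π↭ v∈π deleted with ∈-∃++ v∈π | All.lookup (perm-inRange π↭) v∈π
... | xs , ys , refl | s≤s z≤n , s≤s w≤n with m≤n⇒∃[o]m+o≡n w≤n
...   | z , refl = reinsert-oneMove _ z xs ys (reduce-preimage _ z (unique-middle xs unique)
                                                    (trans (sym (delete-middle xs unique)) deleted))
  where
  unique = perm-unique π↭

-- The family B_k

pattern p∈B  eq = here eq
pattern q∈B  eq = there (here eq)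
pattern r∈B  eq = there (there (here eq))
pattern s∈B  eq = there (there (there (here eq)))
pattern pᶜ∈B eq = there (there (there (there (here eq))))
pattern qᶜ∈B eq = there (there (there (there (there (here eq)))))
pattern rᶜ∈B eq = there (there (there (there (there (there (here eq))))))
pattern sᶜ∈B eq = there (there (there (there (there (there (there (here eq)))))))

pk-oneMove : ∀ ℓ → pk (2 + ℓ) ≡ oneMove rightward ℓ 1 0
pk-oneMove ℓ = cong₂ _++_ (range≡upFrom 1 ℓ) (sym (++-identityʳ _))

rk-oneMove : ∀ z → rk (2 + z) ≡ oneMove rightward 0 1 z
rk-oneMove z = cong (λ xs → 2 ∷ 1 ∷ xs) (range≡upFrom 3 z)

sk-oneMove : ∀ e → sk (suc e) ≡ oneMove rightward 0 e 0
sk-oneMove e = trans (cong (_++ [ 1 ]) (range≡upFrom 2 e)) (sym (++-identityʳ _))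

qkᶜ-oneMove : ∀ e → comp (suc e) (qk (suc e)) ≡ oneMove leftward 0 e 0
qkᶜ-oneMove e = cong (suc e ∷_) (begin
  map (suc (suc e) ∸_) (reverse (range 2 e))     ≡⟨ reverse-map (suc (suc e) ∸_) (range 2 e) ⟩
  reverse (map (suc (suc e) ∸_) (range 2 e))     ≡⟨ cong (reverse ∘ map (suc (suc e) ∸_)) (range≡upFrom 2 e) ⟩
  reverse (map (suc (suc e) ∸_) (upFrom 2 e))    ≡⟨ cong reverse (map-∸-upFrom _ 2 1 e (cong suc (+-comm (suc e) 1))) ⟩
  reverse (reverse (upFrom 1 e))                 ≡⟨ reverse-involutive (upFrom 1 e) ⟩
  upFrom 1 e                                     ≡⟨ ++-identityʳ (upFrom 1 e) ⟨
  upFrom 1 e ++ []                               ∎)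
  where open ≡-Reasoning

DeletionsArePair-prefix : ∀ d ℓ → DeletionsArePair (oneMove d (suc ℓ) 1 0) (upFrom 1 (suc ℓ + 1)) (oneMove d ℓ 1 0)
DeletionsArePair-prefix d ℓ = classify , IsDeletion-moved d (suc ℓ) 1 0 , IsDeletion-first d ℓ 1 0
  where
  classify : ∀ {v} → v ∈ oneMove d (suc ℓ) 1 0 → _
  classify v∈ with delete-oneMove d (suc ℓ) 1 0 v∈
  ... | inj₁ eq                              = inj₁ eq
  ... | inj₂ (inj₁ (_ , refl , eq))          = inj₂ eq
  ... | inj₂ (inj₂ (inj₁ (_ , refl , eq)))   = inj₁ (trans eq (oneMove-zero d (suc ℓ) 0))
  ... | inj₂ (inj₂ (inj₂ (_ , () , _)))

DeletionsArePair-suffix : ∀ d z → DeletionsArePair (oneMove d 0 1 (suc z)) (upFrom 1 (suc (suc z))) (oneMove d 0 1 z)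
DeletionsArePair-suffix d z = classify , IsDeletion-moved d 0 1 (suc z) , IsDeletion-last d 0 1 z
  where
  classify : ∀ {v} → v ∈ oneMove d 0 1 (suc z) → _
  classify v∈ with delete-oneMove d 0 1 (suc z) v∈
  ... | inj₁ eq                              = inj₁ eq
  ... | inj₂ (inj₁ (_ , () , _))
  ... | inj₂ (inj₂ (inj₁ (_ , refl , eq)))   = inj₁ (trans eq (oneMove-zero d 0 (suc z)))
  ... | inj₂ (inj₂ (inj₂ (_ , refl , eq)))   = inj₂ eq

DeletionsArePair-rotation : ∀ d e → DeletionsArePair (oneMove d 0 (suc e) 0) (upFrom 1 (suc e + 0)) (oneMove d 0 e 0)
DeletionsArePair-rotation d e = classify , IsDeletion-moved d 0 (suc e) 0 , IsDeletion-fixed d 0 e 0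
  where
  classify : ∀ {v} → v ∈ oneMove d 0 (suc e) 0 → _
  classify v∈ with delete-oneMove d 0 (suc e) 0 v∈
  ... | inj₁ eq                              = inj₁ eq
  ... | inj₂ (inj₁ (_ , () , _))
  ... | inj₂ (inj₂ (inj₁ (_ , refl , eq)))   = inj₂ eq
  ... | inj₂ (inj₂ (inj₂ (_ , () , _)))

DeletionsArePair-pk : ∀ t → DeletionsArePair (pk (3 + t)) (range 1 (2 + t)) (pk (2 + t))
DeletionsArePair-pk t = DeletionsArePair-cast (sym (pk-oneMove (suc t)))
  (trans (cong (upFrom 1) (+-comm (suc t) 1)) (sym (range≡upFrom 1 (2 + t)))) (sym (pk-oneMove t))
  (DeletionsArePair-prefix rightward t)

DeletionsArePair-rk : ∀ t → DeletionsArePair (rk (3 + t)) (range 1 (2 + t)) (rk (2 + t))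
DeletionsArePair-rk t = DeletionsArePair-cast (sym (rk-oneMove (suc t))) (sym (range≡upFrom 1 (2 + t))) (sym (rk-oneMove t))
  (DeletionsArePair-suffix rightward t)

DeletionsArePair-sk : ∀ t → DeletionsArePair (sk (3 + t)) (range 1 (2 + t)) (sk (2 + t))
DeletionsArePair-sk t = DeletionsArePair-cast (sym (sk-oneMove (2 + t)))
  (trans (cong (upFrom 1) (+-identityʳ (2 + t))) (sym (range≡upFrom 1 (2 + t)))) (sym (sk-oneMove (suc t)))
  (DeletionsArePair-rotation rightward (suc t))

DeletionsArePair-qkᶜ : ∀ t → DeletionsArePair (comp (3 + t) (qk (3 + t))) (range 1 (2 + t)) (comp (2 + t) (qk (2 + t)))
DeletionsArePair-qkᶜ t = DeletionsArePair-cast (sym (qkᶜ-oneMove (2 + t)))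
  (trans (cong (upFrom 1) (+-identityʳ (2 + t))) (sym (range≡upFrom 1 (2 + t)))) (sym (qkᶜ-oneMove (suc t)))
  (DeletionsArePair-rotation leftward (suc t))

InB-comp : ∀ {k w} → All (InRange k) w → InB k w → InB k (comp k w)
InB-comp w∈ (p∈B refl) = pᶜ∈B refl
InB-comp w∈ (q∈B refl) = qᶜ∈B refl
InB-comp w∈ (r∈B refl) = rᶜ∈B refl
InB-comp w∈ (s∈B refl) = sᶜ∈B refl
InB-comp w∈ (pᶜ∈B refl) = p∈B (comp-involutive⁻ w∈)
InB-comp w∈ (qᶜ∈B refl) = q∈B (comp-involutive⁻ w∈)
InB-comp w∈ (rᶜ∈B refl) = r∈B (comp-involutive⁻ w∈)
InB-comp w∈ (sᶜ∈B refl) = s∈B (comp-involutive⁻ w∈)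

InB⇒≢range : ∀ t {b} → InB (3 + t) b → b ≢ range 1 (3 + t)
InB⇒≢range t (p∈B refl) eq =
  oneMove≢upFrom rightward (suc t) 0 0 (3 + t) (trans (sym (pk-oneMove (suc t))) (trans eq (range≡upFrom 1 (3 + t))))
InB⇒≢range t (q∈B refl) eq with ∷-injectiveʳ (trans eq (range≡upFrom 1 (3 + t)))
... | tail≡ with trans (sym (reverse-upFrom-suc 2 (suc t))) (trans (cong reverse (sym (range≡upFrom 2 (2 + t)))) tail≡)
...   | ()
InB⇒≢range t (r∈B refl) eq with ∷-injectiveˡ eq
... | ()
InB⇒≢range t (s∈B refl) eq with ∷-injectiveˡ eq
... | ()
InB⇒≢range t (pᶜ∈B refl) eq with ∷-injectiveˡ eq
... | ()
InB⇒≢range t (qᶜ∈B refl) eq with ∷-injectiveˡ eq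
... | ()
InB⇒≢range t (rᶜ∈B refl) eq with ∷-injectiveˡ eq
... | ()
InB⇒≢range t (sᶜ∈B refl) eq with ∷-injectiveˡ eq
... | ()

oneMove-InB : ∀ d ℓ e z {n b} → DeletionsArePair (oneMove d ℓ (suc e) z) (upFrom 1 n) b →
              InB (ℓ + (suc (suc e) + z)) (oneMove d ℓ (suc e) z)
oneMove-InB d (suc ℓ) e (suc z) {n} pair = ⊥-elim (distinct-deletions
  (IsDeletion-first d ℓ (suc e) (suc z)) (IsDeletion-last d (suc ℓ) (suc e) z)
  (oneMove≢upFrom d ℓ e (suc z) n) (oneMove≢upFrom d (suc ℓ) e z n)
  (λ eq → 1+n≢n (sym (proj₁ (oneMove-injective d {ℓ} {suc ℓ} {e} {e} {suc z} {z} eq)))) pair)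
oneMove-InB d (suc ℓ) (suc e) zero {n} pair = ⊥-elim (distinct-deletions
  (IsDeletion-first d ℓ (suc (suc e)) 0) (IsDeletion-fixed d (suc ℓ) (suc e) 0)
  (oneMove≢upFrom d ℓ (suc e) 0 n) (oneMove≢upFrom d (suc ℓ) e 0 n)
  (λ eq → 1+n≢n (sym (proj₁ (oneMove-injective d {ℓ} {suc ℓ} {suc e} {e} {0} {0} eq)))) pair)
oneMove-InB d zero (suc e) (suc z) {n} pair = ⊥-elim (distinct-deletions
  (IsDeletion-fixed d 0 (suc e) (suc z)) (IsDeletion-last d 0 (suc (suc e)) z)
  (oneMove≢upFrom d 0 e (suc z) n) (oneMove≢upFrom d 0 (suc e) z n)
  (λ eq → 1+n≢n (sym (proj₂ (oneMove-injective d {0} {0} {e} {suc e} {suc z} {z} eq)))) pair)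
oneMove-InB d (suc ℓ) zero zero _ =
  subst (λ k → InB k (oneMove d (suc ℓ) 1 0)) (+-comm 2 (suc ℓ))
        (p∈B (trans (oneMove-transposition d (suc ℓ) 0) (sym (pk-oneMove (suc ℓ)))))
oneMove-InB d zero zero z _ = r∈B (trans (oneMove-transposition d 0 z) (sym (rk-oneMove z)))
oneMove-InB leftward zero (suc e) zero _ =
  subst (λ k → InB k (oneMove leftward 0 (suc (suc e)) 0)) (sym (+-identityʳ (3 + e)))
        (qᶜ∈B (sym (qkᶜ-oneMove (suc (suc e)))))
oneMove-InB rightward zero (suc e) zero _ =
  subst (λ k → InB k (oneMove rightward 0 (suc (suc e)) 0)) (sym (+-identityʳ (3 + e)))
        (s∈B (sym (sk-oneMove (suc (suc e)))))

deletions-of-identity-agree : ∀ {π m u v} → π ≡ upFrom 1 (suc m) → u ∈ π → v ∈ π → delete u π ≡ delete v π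
deletions-of-identity-agree {m = m} refl u∈ v∈ = trans (delete-upFrom 1 m u∈) (sym (delete-upFrom 1 m v∈))

ShadowIsPair-range⇒InB : ∀ t {π b} → IsPerm (4 + t) π → InB (3 + t) b →
                         ShadowIsPair (3 + t) π (range 1 (3 + t)) b → InB (4 + t) π
ShadowIsPair-range⇒InB t {π} {b} π↭ b∈B shadow
  with to (ShadowIsPair⇔DeletionsArePair π↭) shadow
... | pair@(_ , (v , v∈π , id≡) , (u , u∈π , b≡))
  with delete≡identity⇒oneMove π↭ v∈π (trans (sym id≡) (range≡upFrom 1 (3 + t)))
...   | d , ℓ , zero , z , refl = ⊥-elim (InB⇒≢range t b∈B (begin
  b                        ≡⟨ b≡ ⟩
  delete u π               ≡⟨ deletions-of-identity-agree (trans (oneMove-zero d ℓ z) (cong (upFrom 1) (+-suc ℓ z))) u∈π v∈π ⟩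
  delete v π               ≡⟨ id≡ ⟨
  range 1 (3 + t)          ∎))
  where open ≡-Reasoning
...   | d , ℓ , suc e , z , refl =
  subst (λ k → InB k π) (trans (sym (length-oneMove d ℓ (suc e) z)) (perm-length π↭))
        (oneMove-InB d ℓ e z (DeletionsArePair-cast refl (range≡upFrom 1 (3 + t)) refl pair))

ShadowIsPair⇒InB : ∀ t {π m b} → IsPerm (4 + t) π → Monotone (3 + t) m → InB (3 + t) b →
                   ShadowIsPair (3 + t) π m b → InB (4 + t) π
ShadowIsPair⇒InB t π↭ (inj₁ refl) b∈B shadow = ShadowIsPair-range⇒InB t π↭ b∈B shadow
ShadowIsPair⇒InB t {π} {b = b} π↭ (inj₂ refl) b∈B shadow =
  subst (InB (4 + t)) (comp-involutive (perm-inRange π↭))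
        (InB-comp (perm-inRange (comp-perm π↭))
                  (ShadowIsPair-range⇒InB t (comp-perm π↭) (InB-comp b∈range b∈B) shadowᶜ))
  where
  b∈range : All (InRange (3 + t)) b
  b∈range = perm-inRange (proj₁ (from (shadow b) (inj₂ refl)))
  shadowᶜ : ShadowIsPair (3 + t) (comp (4 + t) π) (range 1 (3 + t)) (comp (3 + t) b)
  shadowᶜ = subst (λ m → ShadowIsPair (3 + t) (comp (4 + t) π) m (comp (3 + t) b)) (comp-reverse-range (3 + t))
                  (ShadowIsPair-comp (perm-inRange π↭) shadow)

InB⇒ShadowIsPair : ∀ t {π} → IsPerm (4 + t) π → InB (4 + t) π →
                   ∃[ m ] ∃[ b ] (Monotone (3 + t) m × InB (3 + t) b × ShadowIsPair (3 + t) π m b)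
InB⇒ShadowIsPair t π↭ (p∈B refl) =
  _ , _ , inj₁ refl , p∈B refl , DeletionsArePair⇒ShadowIsPair π↭ (DeletionsArePair-pk (suc t))
InB⇒ShadowIsPair t π↭ (q∈B refl) =
  _ , _ , Monotone-comp (inj₁ refl) , q∈B refl ,
  subst₂ (λ w c → ShadowIsPair n w (comp n (range 1 n)) c)
         (comp-involutive (perm-inRange π↭)) (comp-involutive⁻ (perm-inRange qᶜ↭))
         (DeletionsArePair⇒ShadowIsPair-comp (comp-perm (comp-perm π↭)) (DeletionsArePair-qkᶜ (suc t)))
  where
  n = 3 + t
  qᶜ↭ : IsPerm n (comp n (qk n))
  qᶜ↭ = deletion-perm (comp-perm π↭) (proj₂ (proj₂ (DeletionsArePair-qkᶜ (suc t))))
InB⇒ShadowIsPair t π↭ (r∈B refl) =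
  _ , _ , inj₁ refl , r∈B refl , DeletionsArePair⇒ShadowIsPair π↭ (DeletionsArePair-rk (suc t))
InB⇒ShadowIsPair t π↭ (s∈B refl) =
  _ , _ , inj₁ refl , s∈B refl , DeletionsArePair⇒ShadowIsPair π↭ (DeletionsArePair-sk (suc t))
InB⇒ShadowIsPair t π↭ (pᶜ∈B refl) =
  _ , _ , Monotone-comp (inj₁ refl) , pᶜ∈B refl , DeletionsArePair⇒ShadowIsPair-comp π↭ (DeletionsArePair-pk (suc t))
InB⇒ShadowIsPair t π↭ (qᶜ∈B refl) =
  _ , _ , inj₁ refl , qᶜ∈B refl , DeletionsArePair⇒ShadowIsPair π↭ (DeletionsArePair-qkᶜ (suc t))
InB⇒ShadowIsPair t π↭ (rᶜ∈B refl) =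
  _ , _ , Monotone-comp (inj₁ refl) , rᶜ∈B refl , DeletionsArePair⇒ShadowIsPair-comp π↭ (DeletionsArePair-rk (suc t))
InB⇒ShadowIsPair t π↭ (sᶜ∈B refl) =
  _ , _ , Monotone-comp (inj₁ refl) , sᶜ∈B refl , DeletionsArePair⇒ShadowIsPair-comp π↭ (DeletionsArePair-sk (suc t))

proposition3p3 : (k : ℕ) → 4 ≤ k → (π : List ℕ) → IsPerm k π →
    (InB k π ⇔
      (∃[ m ] ∃[ b ] (Monotone (k ∸ 1) m × InB (k ∸ 1) b ×
        ((σ : List ℕ) → (InShadow (k ∸ 1) π σ ⇔ (σ ≡ m ⊎ σ ≡ b))))))
proposition3p3 (suc (suc (suc (suc t)))) (s≤s (s≤s (s≤s (s≤s z≤n)))) π π↭ =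
  mk⇔ (InB⇒ShadowIsPair t π↭)
      (λ (_ , _ , m-monotone , b∈B , shadow) → ShadowIsPair⇒InB t π↭ m-monotone b∈B shadow)
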